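{- Let $p\ge1$ be an integer and let $G=(V,E)$ be an undirected graph with $V=\{v_1,\dots,v_n\}$ and $E=\{e_1,\dots,e_m\}$. Define $(m+1)$-time series $f_1,\dots,f_n$ by $f_i(1)=m$ for all $i$, and for $j=2,\dots,m+1$, writing $e_{j-1}=\{v_a,v_b\}$ with $a<b$: $f_i(j)=f_i(j-1)+1$ if $i=a$, $f_i(j)=f_i(j-1)-1$ if $i=b$, and $f_i(j)=f_i(j-1)$ otherwise. Let $F=\{f_1,\dots,f_n\}$. Let $\pi^V$ be any permutation of $V$ and let $\pi^F$ be the permutation of $F$ with $\mathrm{pos}_{\pi^F}(f_i)=\mathrm{pos}_{\pi^V}(v_i)$ for all $i\in[n]$. Then $$\sum_{i=1}^n\sum_{j=1}^m|W^{\pi^F}_{i,j}|^p=\sum_{\{u,v\}\in E}|\mathrm{pos}_{\pi^V}(u)-\mathrm{pos}_{\pi^V}(v)|.$$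
   Context: $[n]=\{1,\dots,n\}$. A permutation of a set $X$ of size $n$ is a bijection $\pi:[n]\to X$, and $\mathrm{pos}_\pi(x)=\pi^{ -1}(x)$. For a set $F=\{f_1,\dots,f_n\}$ of $\ell$-time series (functions $[\ell]\to\mathbb{R}_{\ge0}$) and a permutation $\pi$ of $F$, $W^\pi_{i,j}=\sum_{k=1}^i(\pi(k)(j+1)-\pi(k)(j))$ for $i\in\{0,\dots,n\}$, $j\in[\ell-1]$. -}

module Defs where

open import Data.Nat as ℕ using (ℕ; zero; suc; _<ᵇ_)
open import Data.Integer as ℤ using (ℤ; +_; 0ℤ; 1ℤ; -1ℤ)
open import Data.Fin as Fin using (Fin; zero; suc; toℕ; inject₁; _≟_)
open import Data.Bool using (if_then_else_)
open import Data.Product using (_×_; proj₁; proj₂)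
open import Relation.Nullary.Decidable using (does; yes; no)

Σℕ : ∀ {n} → (Fin n → ℕ) → ℕ
Σℕ {zero}  f = 0
Σℕ {suc n} f = f zero ℕ.+ Σℕ (λ k → f (suc k))

Σℤ : ∀ {n} → (Fin n → ℤ) → ℤ
Σℤ {zero}  f = 0ℤ
Σℤ {suc n} f = f zero ℤ.+ Σℤ (λ k → f (suc k))

-- An ℓ-time series: time index t ∈ [ℓ] is represented by (t-1) : Fin ℓ.
-- Values are integers (all series of this lemma are integer valued).
TimeSeries : ℕ → Set
TimeSeries ℓ = Fin ℓ → ℤ

-- W^π_{i,j} for a sequence π : positions (0-based Fin n) → series of length suc L,
-- i ∈ {0..n} (ℕ, counts the first i positions), j ∈ [L] represented by Fin L
-- (j : Fin L stands for time toℕ j + 1, so j+1 is suc j).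
W : ∀ {n L} → (Fin n → TimeSeries (suc L)) → ℕ → Fin L → ℤ
W {n} π i j = Σℤ (λ (k : Fin n) →
  if toℕ k <ᵇ i then (π k (suc j) ℤ.- π k (inject₁ j)) else 0ℤ)

step : ∀ {n} → Fin n → Fin n × Fin n → ℤ
step i e =
  if does (i ≟ proj₁ e) then 1ℤ
  else if does (i ≟ proj₂ e) then -1ℤ
  else 0ℤ

-- The (m+1)-time series f_i built from edges e_1..e_m (edge e_{t} is edges (t-1)).
-- Time 1 is zero; time (toℕ j + 2) is suc j, using edge e_{toℕ j + 1} = edges j.
seriesℕ : ∀ {n m} → (Fin m → Fin n × Fin n) → Fin n → ℕ → ℤ
seriesℕ {m = m} edges i zero = + m
seriesℕ {m = m} edges i (suc t) with t ℕ.<? m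
... | yes t<m = seriesℕ edges i t ℤ.+ step i (edges (Fin.fromℕ< t<m))
... | no _    = seriesℕ edges i t   -- unreachable from series: toℕ j ≤ m

series : ∀ {n m} → (Fin m → Fin n × Fin n) → Fin n → TimeSeries (suc m)
series edges i j = seriesℕ edges i (toℕ j)

-- Fix an edge e_j = {a, b}. Along the permutation, only the series of a and b move at
-- time j, by +1 and -1, so W_{i,j} = [pos a < i] - [pos b < i] ∈ {-1, 0, 1} and its
-- p-th power is its absolute value. Summed over i this counts the thresholds i lying
-- between the two positions, which is |pos a - pos b|; exchanging the sums over i and j
-- gives the identity edge by edge.
module Submission where

open import Defs
open import Data.Nat using (ℕ; _≤_; _^_; ∣_-_∣)
open import Data.Integer using (∣_∣)
open import Data.Fin using (Fin; toℕ; _<_)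
open import Data.Fin.Permutation using (Permutation′; _⟨$⟩ʳ_; _⟨$⟩ˡ_)
open import Data.Product using (_×_; proj₁; proj₂)
open import Function.Definitions using (Injective)
open import Relation.Binary.PropositionalEquality using (_≡_)
open import Data.Nat using (suc)

open import Data.Bool using (Bool; true; false; if_then_else_)
open import Data.Bool.Properties using (if-eta)
open import Data.Empty using (⊥-elim)
open import Data.Fin using (zero; suc; inject₁; _≟_)
open import Data.Fin.Permutation using (Permutation; inverseˡ; inverseʳ)
import Data.Fin.Properties as FP
open import Data.Integer as ℤ using (ℤ; +_; 0ℤ)
open import Data.Integer.Properties using (+-identityˡ)
open import Data.Integer.Tactic.RingSolver using (solve-∀)
open import Data.Nat as ℕ using (zero; z≤n; s≤s; _<ᵇ_)
import Data.Nat.Properties as NP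
open import Algebra.Properties.CommutativeMonoid.Sum NP.+-0-commutativeMonoid using (sum; ∑-comm)
open import Data.Product using (_,_)
open import Relation.Nullary using (¬_; does; yes; no)
open import Relation.Binary.PropositionalEquality
  using (refl; sym; trans; cong; cong₂; module ≡-Reasoning)

Σℕ-cong : ∀ {n} {f g : Fin n → ℕ} → (∀ k → f k ≡ g k) → Σℕ f ≡ Σℕ g
Σℕ-cong {zero}  f≗g = refl
Σℕ-cong {suc n} f≗g = cong₂ ℕ._+_ (f≗g zero) (Σℕ-cong (λ k → f≗g (suc k)))

Σℕ≡sum : ∀ {n} (f : Fin n → ℕ) → Σℕ f ≡ sum f
Σℕ≡sum {zero}  f = refl
Σℕ≡sum {suc n} f = cong (f zero ℕ.+_) (Σℕ≡sum (λ k → f (suc k)))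

Σℕ-comm : ∀ {n m} (f : Fin n → Fin m → ℕ) →
  Σℕ (λ i → Σℕ (λ j → f i j)) ≡ Σℕ (λ j → Σℕ (λ i → f i j))
Σℕ-comm f = begin
  Σℕ (λ i → Σℕ (f i))              ≡⟨ Σℕ-cong (λ i → Σℕ≡sum (f i)) ⟩
  Σℕ (λ i → sum (f i))             ≡⟨ Σℕ≡sum (λ i → sum (f i)) ⟩
  sum (λ i → sum (f i))            ≡⟨ ∑-comm f ⟩
  sum (λ j → sum (λ i → f i j))    ≡⟨ sym (Σℕ≡sum (λ j → sum (λ i → f i j))) ⟩
  Σℕ (λ j → sum (λ i → f i j))     ≡⟨ Σℕ-cong (λ j → sym (Σℕ≡sum (λ i → f i j))) ⟩
  Σℕ (λ j → Σℕ (λ i → f i j))      ∎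
  where open ≡-Reasoning

Σℤ-cong : ∀ {n} {f g : Fin n → ℤ} → (∀ k → f k ≡ g k) → Σℤ f ≡ Σℤ g
Σℤ-cong {zero}  f≗g = refl
Σℤ-cong {suc n} f≗g = cong₂ ℤ._+_ (f≗g zero) (Σℤ-cong (λ k → f≗g (suc k)))

Σℤ-zero : ∀ n → Σℤ {n} (λ _ → 0ℤ) ≡ 0ℤ
Σℤ-zero zero    = refl
Σℤ-zero (suc n) = trans (+-identityˡ _) (Σℤ-zero n)

Σℤ-distrib-minus : ∀ {n} (f g : Fin n → ℤ) → Σℤ (λ k → f k ℤ.- g k) ≡ Σℤ f ℤ.- Σℤ g
Σℤ-distrib-minus {zero}  f g = refl
Σℤ-distrib-minus {suc n} f g =
  trans (cong (λ s → f zero ℤ.- g zero ℤ.+ s) (Σℤ-distrib-minus (λ k → f (suc k)) (λ k → g (suc k))))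
        (interchange (f zero) (g zero) _ _)
  where
  interchange : ∀ a b c d → a ℤ.- b ℤ.+ (c ℤ.- d) ≡ a ℤ.+ c ℤ.- (b ℤ.+ d)
  interchange = solve-∀

χ : Bool → ℕ
χ b = if b then 1 else 0

δ : ∀ {n} → Fin n → Fin n → ℤ
δ x y = if does (x ≟ y) then ℤ.1ℤ else 0ℤ

δ-permute : ∀ {m n} (π : Permutation m n) k a → δ (π ⟨$⟩ʳ k) a ≡ δ k (π ⟨$⟩ˡ a)
δ-permute π k a with π ⟨$⟩ʳ k ≟ a | k ≟ π ⟨$⟩ˡ a
... | yes _     | yes _    = refl
... | no _      | no _     = refl
... | yes refl  | no k≢πˡa = ⊥-elim (k≢πˡa (sym (inverseˡ π)))
... | no πʳk≢a  | yes refl = ⊥-elim (πʳk≢a (inverseʳ π))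

step≡δ-δ : ∀ {n} (v a b : Fin n) → ¬ a ≡ b → step v (a , b) ≡ δ v a ℤ.- δ v b
step≡δ-δ v a b a≢b with v ≟ a | v ≟ b
... | yes refl | yes refl = ⊥-elim (a≢b refl)
... | yes _    | no _     = refl
... | no _     | yes _    = refl
... | no _     | no _     = refl

series-increment : ∀ {n m} (edges : Fin m → Fin n × Fin n) v (j : Fin m) →
  series edges v (suc j) ℤ.- series edges v (inject₁ j) ≡ step v (edges j)
series-increment {m = m} edges v j
  rewrite FP.toℕ-inject₁ j with toℕ j ℕ.<? m
... | no j≮m = ⊥-elim (j≮m (FP.toℕ<n j))
... | yes j<m rewrite FP.fromℕ<-toℕ j j<m = cancel (seriesℕ edges v (toℕ j)) (step v (edges j))
  where
  cancel : ∀ a s → a ℤ.+ s ℤ.- a ≡ s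
  cancel = solve-∀

prefix-δ : ∀ {n} (c : ℕ) (x : Fin n) →
  Σℤ (λ k → if toℕ k <ᵇ c then δ k x else 0ℤ) ≡ + χ (toℕ x <ᵇ c)
prefix-δ {suc n} zero    x       = Σℤ-zero (suc n)
prefix-δ {suc n} (suc c) zero    =
  cong (λ s → ℤ.1ℤ ℤ.+ s) (trans (Σℤ-cong {n} (λ k → if-eta (toℕ k <ᵇ c))) (Σℤ-zero n))
prefix-δ {suc n} (suc c) (suc x) = trans (+-identityˡ _) (prefix-δ c x)

W-dipole : ∀ {n L} (π : Fin n → TimeSeries (suc L)) (j : Fin L) (x y : Fin n) →
  (∀ k → π k (suc j) ℤ.- π k (inject₁ j) ≡ δ k x ℤ.- δ k y) →
  ∀ c → W π c j ≡ + χ (toℕ x <ᵇ c) ℤ.- + χ (toℕ y <ᵇ c)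
W-dipole {n} π j x y increment c = begin
  W π c j                                           ≡⟨ Σℤ-cong restrict ⟩
  Σℤ (λ k → prefix k x ℤ.- prefix k y)              ≡⟨ Σℤ-distrib-minus (λ k → prefix k x) (λ k → prefix k y) ⟩
  Σℤ (λ k → prefix k x) ℤ.- Σℤ (λ k → prefix k y)   ≡⟨ cong₂ ℤ._-_ (prefix-δ c x) (prefix-δ c y) ⟩
  + χ (toℕ x <ᵇ c) ℤ.- + χ (toℕ y <ᵇ c)             ∎
  where
  open ≡-Reasoning
  prefix : Fin n → Fin n → ℤ
  prefix k z = if toℕ k <ᵇ c then δ k z else 0ℤ
  if-minus : ∀ b (u v : ℤ) → (if b then u ℤ.- v else 0ℤ) ≡ (if b then u else 0ℤ) ℤ.- (if b then v else 0ℤ)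
  if-minus true  u v = refl
  if-minus false u v = refl
  restrict : ∀ k → (if toℕ k <ᵇ c then π k (suc j) ℤ.- π k (inject₁ j) else 0ℤ) ≡ prefix k x ℤ.- prefix k y
  restrict k = trans (cong (λ d → if toℕ k <ᵇ c then d else 0ℤ) (increment k))
                     (if-minus (toℕ k <ᵇ c) (δ k x) (δ k y))

∣χ-χ∣^suc : ∀ p b b′ → ∣ + χ b ℤ.- + χ b′ ∣ ^ suc p ≡ ∣ χ b - χ b′ ∣
∣χ-χ∣^suc p true  true  = refl
∣χ-χ∣^suc p true  false = NP.^-zeroˡ (suc p)
∣χ-χ∣^suc p false true  = NP.^-zeroˡ (suc p)
∣χ-χ∣^suc p false false = refl

Σ-separating-thresholds : ∀ n x y → x ≤ n → y ≤ n →
  Σℕ {n} (λ i → ∣ χ (x <ᵇ suc (toℕ i)) - χ (y <ᵇ suc (toℕ i)) ∣) ≡ ∣ x - y ∣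
Σ-separating-thresholds zero    zero    zero    _         _         = refl
Σ-separating-thresholds (suc n) zero    zero    _         _         =
  Σ-separating-thresholds n zero zero z≤n z≤n
Σ-separating-thresholds (suc n) zero    (suc y) _         (s≤s y≤n) =
  cong suc (Σ-separating-thresholds n zero y z≤n y≤n)
Σ-separating-thresholds (suc n) (suc x) zero    (s≤s x≤n) _         =
  cong suc (trans (Σ-separating-thresholds n x zero x≤n z≤n) (NP.∣-∣-identityʳ x))
Σ-separating-thresholds (suc n) (suc x) (suc y) (s≤s x≤n) (s≤s y≤n) =
  Σ-separating-thresholds n x y x≤n y≤n

Σ∣W-dipole∣^suc : ∀ {n L} p (π : Fin n → TimeSeries (suc L)) (j : Fin L) (x y : Fin n) →
  (∀ k → π k (suc j) ℤ.- π k (inject₁ j) ≡ δ k x ℤ.- δ k y) →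
  Σℕ (λ (i : Fin n) → ∣ W π (suc (toℕ i)) j ∣ ^ suc p) ≡ ∣ toℕ x - toℕ y ∣
Σ∣W-dipole∣^suc {n} p π j x y increment =
  trans (Σℕ-cong {n} term) (Σ-separating-thresholds n (toℕ x) (toℕ y) (bound x) (bound y))
  where
  bound : (z : Fin n) → toℕ z ≤ n
  bound z = NP.<⇒≤ (FP.toℕ<n z)
  term : ∀ i → ∣ W π (suc (toℕ i)) j ∣ ^ suc p
             ≡ ∣ χ (toℕ x <ᵇ suc (toℕ i)) - χ (toℕ y <ᵇ suc (toℕ i)) ∣
  term i = trans (cong (λ w → ∣ w ∣ ^ suc p) (W-dipole π j x y increment (suc (toℕ i))))
                 (∣χ-χ∣^suc p (toℕ x <ᵇ suc (toℕ i)) (toℕ y <ᵇ suc (toℕ i)))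

lemma13 : (p n m : ℕ) → 1 ≤ p →
    (edges : Fin m → Fin n × Fin n) →
    (∀ j → proj₁ (edges j) < proj₂ (edges j)) →
    Injective _≡_ _≡_ edges →
    (πV : Permutation′ n) →
    (πF : Fin n → TimeSeries (suc m)) →
    (∀ i → πF (πV ⟨$⟩ˡ i) ≡ series edges i) →
    Σℕ (λ (i : Fin n) → Σℕ (λ (j : Fin m) → ∣ W πF (suc (toℕ i)) j ∣ ^ p))
      ≡ Σℕ (λ (j : Fin m) →
          ∣ toℕ (πV ⟨$⟩ˡ proj₁ (edges j)) - toℕ (πV ⟨$⟩ˡ proj₂ (edges j)) ∣)
lemma13 (suc p) n m _ edges a<b _ πV πF πF≡series =
  trans (Σℕ-comm {n} {m} _) (Σℕ-cong {m} (λ j → Σ∣W-dipole∣^suc p πF j _ _ (increment j)))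
  where
  πF≡series∘πV : ∀ k → πF k ≡ series edges (πV ⟨$⟩ʳ k)
  πF≡series∘πV k = trans (cong πF (sym (inverseˡ πV))) (πF≡series (πV ⟨$⟩ʳ k))

  increment : ∀ j k → πF k (suc j) ℤ.- πF k (inject₁ j)
    ≡ δ k (πV ⟨$⟩ˡ proj₁ (edges j)) ℤ.- δ k (πV ⟨$⟩ˡ proj₂ (edges j))
  increment j k = begin
    πF k (suc j) ℤ.- πF k (inject₁ j)
      ≡⟨ cong (λ f → f (suc j) ℤ.- f (inject₁ j)) (πF≡series∘πV k) ⟩
    series edges (πV ⟨$⟩ʳ k) (suc j) ℤ.- series edges (πV ⟨$⟩ʳ k) (inject₁ j)
      ≡⟨ series-increment edges (πV ⟨$⟩ʳ k) j ⟩
    step (πV ⟨$⟩ʳ k) (edges j)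
      ≡⟨ step≡δ-δ (πV ⟨$⟩ʳ k) a b (λ a≡b → NP.<-irrefl (cong toℕ a≡b) (a<b j)) ⟩
    δ (πV ⟨$⟩ʳ k) a ℤ.- δ (πV ⟨$⟩ʳ k) b
      ≡⟨ cong₂ ℤ._-_ (δ-permute πV k a) (δ-permute πV k b) ⟩
    δ k (πV ⟨$⟩ˡ a) ℤ.- δ k (πV ⟨$⟩ˡ b) ∎
    where
    open ≡-Reasoning
    a = proj₁ (edges j)
    b = proj₂ (edges j)
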